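{- Let $H$ be a graph on $n-l$ vertices with $\Delta(H)\le d$ that contains no $kS_{d+1}$ as a subgraph. Then $H$ has at most $(k-1)(d^2+1)$ vertices of degree $d$.
   Context: $S_{d+1}$ denotes the star $K_{1,d}$ and $kS_{d+1}$ denotes the disjoint union of $k$ copies of $S_{d+1}$. $\Delta$ is the maximum degree. -}

module Defs where

open import Data.Nat using (ℕ; zero; suc; _≟_)
open import Data.Bool using (Bool; true; false; if_then_else_)
open import Data.Fin using (Fin; zero; suc)
open import Data.List using (List; map; allFin)
open import Data.Nat.ListAction using (sum)
open import Data.Product using (_×_; _,_)
open import Relation.Binary.PropositionalEquality using (_≡_)
open import Relation.Nullary using (¬_)
open import Relation.Nullary.Decidable using (⌊_⌋)
open import Function.Definitions using (Injective)

record Graph (N : ℕ) : Set where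
  field
    Adj   : Fin N → Fin N → Bool
    sym   : ∀ u v → Adj u v ≡ Adj v u
    irrefl : ∀ v → Adj v v ≡ false
open Graph public

degree : ∀ {N} → Graph N → Fin N → ℕ
degree {N} G v = sum (map (λ u → if Adj G v u then 1 else 0) (allFin N))

MaxDegreeAtMost : ∀ {N} → Graph N → ℕ → Set
MaxDegreeAtMost G d = ∀ v → degree G v Data.Nat.≤ d

numDegree : ∀ {N} → Graph N → ℕ → ℕ
numDegree {N} G d = sum (map (λ v → if ⌊ degree G v ≟ d ⌋ then 1 else 0) (allFin N))

-- kS_{d+1}: vertex set Fin k × Fin (suc d); in copy i the centre is (i , zero)
-- and the leaves are (i , suc j), j : Fin d, each adjacent to the centre.
-- G contains kS_{d+1} as a (not necessarily induced) subgraph iff there is an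
-- injective map of these vertices into G sending every star edge to an edge of G.
ContainsKStars : ∀ {N} → Graph N → ℕ → ℕ → Set
ContainsKStars {N} G k d =
  Data.Product.Σ (Fin k × Fin (suc d) → Fin N) λ f →
    Injective _≡_ _≡_ f ×
    (∀ (i : Fin k) (j : Fin d) → Adj G (f (i , zero)) (f (i , suc j)) ≡ true)

-- If H had more than (k − 1)(d² + 1) vertices of degree d, pick them greedily so that
-- no two chosen vertices are at distance at most 2: a vertex has at most d + d(d − 1) = d²
-- other vertices within distance 2, so each choice discards at most d² + 1 candidates and
-- k choices are possible. The closed neighbourhoods of the k chosen vertices are then
-- pairwise disjoint and each is a star K_{1,d}, giving a copy of kS_{d+1} in H.
module Submission where

open import Defs
open import Data.Bool using (Bool; true; false; if_then_else_; T) renaming (_≟_ to _≟ᵇ_)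
open import Data.Bool.Properties using (T?; T-≡)
open import Data.Fin using (Fin)
open import Data.Fin.Properties using (any?) renaming (_≟_ to _≟ᶠ_)
open import Data.List using (List; []; _∷_; _++_; length; filter; map; allFin; concatMap; lookup)
open import Data.List.Properties using (length-++; filter-notAll)
open import Data.List.Membership.Propositional using (_∈_; _∉_)
open import Data.List.Membership.Propositional.Properties
  using (∈-filter⁺; ∈-filter⁻; ∈-++⁺ˡ; ∈-++⁺ʳ; ∈-concatMap⁺; ∈-lookup; ∈-allFin)
import Data.List.Relation.Unary.All as All
open import Data.List.Relation.Unary.Any as Any using (here; there)
open import Data.List.Relation.Unary.AllPairs using (_∷_)
open import Data.List.Relation.Unary.Unique.Propositional using (Unique)
import Data.List.Relation.Unary.Unique.Propositional.Properties as Unique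
open import Data.Nat using (ℕ; zero; suc; _≤_; _<_; _∸_; _*_; _+_; _^_; z≤n; s≤s; _≟_; _≤?_)
open import Data.Nat.ListAction using (sum)
open import Data.Nat.Properties
open import Data.Product using (Σ; ∃; _×_; _,_; proj₁; proj₂)
open import Data.Sum using (_⊎_; inj₁; inj₂)
open import Function.Bundles using (Equivalence)
open import Function.Definitions using (Injective)
open import Relation.Nullary using (¬_; yes; no; ¬?; contradiction)
open import Relation.Nullary.Decidable using (⌊_⌋; _⊎-dec_; _×-dec_; toWitness)
open import Relation.Unary using (Decidable; ∁)
open import Relation.Unary.Properties using (∁?)
open import Relation.Binary.Definitions using (DecidableEquality; Symmetric)
import Relation.Binary.Definitions as B
import Relation.Binary.PropositionalEquality as ≡
open ≡ using (_≡_; _≢_; refl; trans; cong; subst)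

module _ {A : Set} where

  sum-indicator≡length-filter : (b : A → Bool) (xs : List A) →
    sum (map (λ x → if b x then 1 else 0) xs) ≡ length (filter (λ x → T? (b x)) xs)
  sum-indicator≡length-filter b [] = refl
  sum-indicator≡length-filter b (x ∷ xs) with b x
  ... | true  = cong suc (sum-indicator≡length-filter b xs)
  ... | false = sum-indicator≡length-filter b xs

  length-filter+length-filter-∁ : {P : A → Set} (P? : Decidable P) (xs : List A) →
    length (filter P? xs) + length (filter (∁? P?) xs) ≡ length xs
  length-filter+length-filter-∁ P? [] = refl
  length-filter+length-filter-∁ P? (x ∷ xs) with P? x
  ... | yes _ = cong suc (length-filter+length-filter-∁ P? xs)
  ... | no  _ = trans (+-suc _ _) (cong suc (length-filter+length-filter-∁ P? xs))

  length-concatMap≤ : ∀ {B : Set} (f : A → List B) (b : ℕ) (xs : List A) →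
    (∀ {x} → x ∈ xs → length (f x) ≤ b) → length (concatMap f xs) ≤ length xs * b
  length-concatMap≤ f b [] _ = z≤n
  length-concatMap≤ f b (x ∷ xs) f≤b = begin
    length (f x ++ concatMap f xs) ≡⟨ length-++ (f x) ⟩
    length (f x) + length (concatMap f xs)   ≤⟨ +-mono-≤ (f≤b (here refl)) (length-concatMap≤ f b xs (λ x∈ → f≤b (there x∈))) ⟩
    b + length xs * b                        ∎
    where open ≤-Reasoning

  lookup-injective : (xs : List A) → Unique xs → Injective _≡_ _≡_ (lookup xs)
  lookup-injective (x ∷ xs) _           {Fin.zero}  {Fin.zero}  _  = refl
  lookup-injective (x ∷ xs) (x∉xs ∷ _)  {Fin.zero}  {Fin.suc j} eq = contradiction eq (All.lookup x∉xs (∈-lookup j))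
  lookup-injective (x ∷ xs) (x∉xs ∷ _)  {Fin.suc i} {Fin.zero}  eq = contradiction (≡.sym eq) (All.lookup x∉xs (∈-lookup i))
  lookup-injective (x ∷ xs) (_ ∷ xs!)   {Fin.suc i} {Fin.suc j} eq = cong Fin.suc (lookup-injective xs xs! eq)

  Unique⇒injection-from-Fin : ∀ {n} (xs : List A) → Unique xs → length xs ≡ n →
    Σ (Fin n → A) λ g → (∀ j → g j ∈ xs) × Injective _≡_ _≡_ g
  Unique⇒injection-from-Fin xs xs! refl = lookup xs , ∈-lookup , lookup-injective xs xs!

  module _ (_≟_ : DecidableEquality A) where

    Unique-⊆⇒length≤ : (xs ys : List A) → Unique xs → (∀ {x} → x ∈ xs → x ∈ ys) →
      length xs ≤ length ys
    Unique-⊆⇒length≤ []       ys _            _     = z≤n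
    Unique-⊆⇒length≤ (x ∷ xs) ys (x∉xs ∷ xs!) xs⊆ys = ≤-trans (s≤s xs≤ys-x) ys-x<ys
      where
      ≢x? : Decidable (_≢ x)
      ≢x? y = ¬? (y ≟ x)
      ys-x<ys : length (filter ≢x? ys) < length ys
      ys-x<ys = filter-notAll ≢x? ys (Any.map (λ { refl y≢y → y≢y refl }) (xs⊆ys (here refl)))
      xs≤ys-x : length xs ≤ length (filter ≢x? ys)
      xs≤ys-x = Unique-⊆⇒length≤ xs (filter ≢x? ys) xs!
        (λ y∈xs → ∈-filter⁺ ≢x? (xs⊆ys (there y∈xs)) (λ { refl → All.lookup x∉xs y∈xs refl }))

module GreedyIndependent
  {A : Set} (_≟_ : DecidableEquality A)
  {R : A → A → Set} (R? : B.Decidable R) (R-sym : Symmetric R)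
  (ball : A → List A) (b : ℕ)
  (∈-ball : ∀ {v u} → R v u → u ≢ v → u ∈ ball v)
  (length-ball≤ : ∀ v → length (ball v) ≤ b)
  where

  Independent : ℕ → List A → Set
  Independent k S = Σ (Fin k → A) λ c → (∀ i → c i ∈ S) × (∀ i j → i ≢ j → ¬ R (c i) (c j))

  far? : (v : A) → Decidable (∁ (R v))
  far? v = ∁? (R? v)

  length-filter-related≤ : ∀ {v S} → v ∉ S → Unique S → length (filter (R? v) S) ≤ b
  length-filter-related≤ {v} {S} v∉S S! = ≤-trans
    (Unique-⊆⇒length≤ _≟_ (filter (R? v) S) (ball v) (Unique.filter⁺ (R? v) S!) related⊆ball)
    (length-ball≤ v)
    where
    related⊆ball : ∀ {u} → u ∈ filter (R? v) S → u ∈ ball v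
    related⊆ball u∈ with ∈-filter⁻ (R? v) {xs = S} u∈
    ... | u∈S , Rvu = ∈-ball Rvu (λ { refl → v∉S u∈S })

  length-filter-far> : ∀ {v S} m → v ∉ S → Unique S →
    suc m * suc b ≤ length S → m * suc b < length (filter (far? v) S)
  length-filter-far> {v} {S} m v∉S S! long = +-cancelˡ-≤ b _ _ (begin
    b + suc (m * suc b)                            ≡⟨ +-suc b _ ⟩
    suc m * suc b                                  ≤⟨ long ⟩
    length S                                       ≡⟨ ≡.sym (length-filter+length-filter-∁ (R? v) S) ⟩
    length (filter (R? v) S) + length (filter (far? v) S)
                                                   ≤⟨ +-monoˡ-≤ _ (length-filter-related≤ v∉S S!) ⟩
    b + length (filter (far? v) S)                 ∎)
    where open ≤-Reasoning

  cons-independent : ∀ {k} v S → Independent k (filter (far? v) S) → Independent (suc k) (v ∷ S)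
  cons-independent {k} v S (c , c∈ , c-far) = c′ , c′∈ , c′-far
    where
    far-v : ∀ i → c i ∈ S × ¬ R v (c i)
    far-v i = ∈-filter⁻ (far? v) {xs = S} (c∈ i)
    c′ : Fin (suc k) → A
    c′ Fin.zero    = v
    c′ (Fin.suc i) = c i
    c′∈ : ∀ i → c′ i ∈ v ∷ S
    c′∈ Fin.zero    = here refl
    c′∈ (Fin.suc i) = there (proj₁ (far-v i))
    c′-far : ∀ i j → i ≢ j → ¬ R (c′ i) (c′ j)
    c′-far Fin.zero    Fin.zero    0≢0 = contradiction refl 0≢0
    c′-far Fin.zero    (Fin.suc j) _   = proj₂ (far-v j)
    c′-far (Fin.suc i) Fin.zero    _   = λ Rciv → proj₂ (far-v i) (R-sym Rciv)
    c′-far (Fin.suc i) (Fin.suc j) i≢j = c-far i j (λ i≡j → i≢j (cong Fin.suc i≡j))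

  length>⇒Independent : ∀ k S → Unique S → (k ∸ 1) * suc b < length S → Independent k S
  length>⇒Independent zero          S       _ _ = (λ ()) , (λ ()) , (λ ())
  length>⇒Independent (suc zero)    (v ∷ S) _ _ = (λ _ → v) , (λ _ → here refl) , λ { Fin.zero Fin.zero 0≢0 → contradiction refl 0≢0 }
  length>⇒Independent (suc (suc m)) (v ∷ S) vS!@(_ ∷ S!) (s≤s long) = cons-independent v S
    (length>⇒Independent (suc m) (filter (far? v) S) (Unique.filter⁺ (far? v) S!)
      (length-filter-far> m (Unique.Unique[x∷xs]⇒x∉xs vS!) S! long))

module Neighbourhoods {N : ℕ} (G : Graph N) where

  neighbours : Fin N → List (Fin N)
  neighbours v = filter (λ u → T? (Adj G v u)) (allFin N)

  length-neighbours : ∀ v → length (neighbours v) ≡ degree G v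
  length-neighbours v = ≡.sym (sum-indicator≡length-filter (Adj G v) (allFin N))

  neighbours-unique : ∀ v → Unique (neighbours v)
  neighbours-unique v = Unique.filter⁺ _ (Unique.allFin⁺ N)

  adjacent⇒∈neighbours : ∀ {v u} → Adj G v u ≡ true → u ∈ neighbours v
  adjacent⇒∈neighbours {v} {u} vu = ∈-filter⁺ (λ u → T? (Adj G v u)) (∈-allFin u) (Equivalence.from T-≡ vu)

  ∈neighbours⇒adjacent : ∀ {v u} → u ∈ neighbours v → Adj G v u ≡ true
  ∈neighbours⇒adjacent {v} u∈ = Equivalence.to T-≡ (proj₂ (∈-filter⁻ (λ u → T? (Adj G v u)) {xs = allFin N} u∈))

  adjacent-sym : ∀ {u v} → Adj G u v ≡ true → Adj G v u ≡ true
  adjacent-sym {u} {v} uv = trans (Graph.sym G v u) uv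

  InClosedNeighbourhood : Fin N → Fin N → Set
  InClosedNeighbourhood v x = x ≡ v ⊎ Adj G v x ≡ true

  inClosedNeighbourhood? : ∀ v → Decidable (InClosedNeighbourhood v)
  inClosedNeighbourhood? v x = (x ≟ᶠ v) ⊎-dec (Adj G v x ≟ᵇ true)

  ClosedNeighbourhoodsMeet : Fin N → Fin N → Set
  ClosedNeighbourhoodsMeet v u = ∃ λ x → InClosedNeighbourhood v x × InClosedNeighbourhood u x

  closedNeighbourhoodsMeet? : B.Decidable ClosedNeighbourhoodsMeet
  closedNeighbourhoodsMeet? v u = any? (λ x → inClosedNeighbourhood? v x ×-dec inClosedNeighbourhood? u x)

  closedNeighbourhoodsMeet-sym : Symmetric ClosedNeighbourhoodsMeet
  closedNeighbourhoodsMeet-sym (x , vx , ux) = x , ux , vx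

  neighboursOtherThan : Fin N → Fin N → List (Fin N)
  neighboursOtherThan v w = filter (λ u → ¬? (u ≟ᶠ v)) (neighbours w)

  secondNeighbourhood : Fin N → List (Fin N)
  secondNeighbourhood v = neighbours v ++ concatMap (neighboursOtherThan v) (neighbours v)

  ∈-secondNeighbourhood : ∀ {v u} → ClosedNeighbourhoodsMeet v u → u ≢ v → u ∈ secondNeighbourhood v
  ∈-secondNeighbourhood (_ , inj₁ refl , inj₁ refl) u≢u = contradiction refl u≢u
  ∈-secondNeighbourhood (_ , inj₁ refl , inj₂ ux)   _   = ∈-++⁺ˡ (adjacent⇒∈neighbours (adjacent-sym ux))
  ∈-secondNeighbourhood (_ , inj₂ vx   , inj₁ refl) _   = ∈-++⁺ˡ (adjacent⇒∈neighbours vx)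
  ∈-secondNeighbourhood {v} (_ , inj₂ vx , inj₂ ux) u≢v = ∈-++⁺ʳ (neighbours v)
    (∈-concatMap⁺ (neighboursOtherThan v)
      (Any.map (λ { refl → ∈-filter⁺ (λ u → ¬? (u ≟ᶠ v)) (adjacent⇒∈neighbours (adjacent-sym ux)) u≢v })
               (adjacent⇒∈neighbours vx)))

  length-secondNeighbourhood≤ : ∀ {d} → MaxDegreeAtMost G d → ∀ v → length (secondNeighbourhood v) ≤ d * d
  length-secondNeighbourhood≤ {d} Δ≤d v = begin
    length (secondNeighbourhood v)                              ≡⟨ length-++ (neighbours v) ⟩
    length (neighbours v) + length (concatMap (neighboursOtherThan v) (neighbours v))
      ≤⟨ +-monoʳ-≤ (length (neighbours v)) (length-concatMap≤ _ (d ∸ 1) (neighbours v) others≤) ⟩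
    length (neighbours v) + length (neighbours v) * (d ∸ 1)   ≤⟨ +-mono-≤ (neighbours≤ v) (*-monoˡ-≤ (d ∸ 1) (neighbours≤ v)) ⟩
    d + d * (d ∸ 1)                                             ≡⟨ n+n*[n∸1]≡n*n d ⟩
    d * d                                                       ∎
    where
    open ≤-Reasoning
    n+n*[n∸1]≡n*n : ∀ n → n + n * (n ∸ 1) ≡ n * n
    n+n*[n∸1]≡n*n zero    = refl
    n+n*[n∸1]≡n*n (suc n) = ≡.sym (*-suc (suc n) n)
    neighbours≤ : ∀ w → length (neighbours w) ≤ d
    neighbours≤ w = ≤-trans (≤-reflexive (length-neighbours w)) (Δ≤d w)
    -- v is a neighbour of w, so the filter removes at least one element.
    others≤ : ∀ {w} → w ∈ neighbours v → length (neighboursOtherThan v w) ≤ d ∸ 1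
    others≤ {w} w∈ = ∸-monoˡ-≤ 1 (≤-trans
      (filter-notAll (λ u → ¬? (u ≟ᶠ v)) (neighbours w)
        (Any.map (λ { refl v≢v → v≢v refl }) (adjacent⇒∈neighbours (adjacent-sym (∈neighbours⇒adjacent w∈)))))
      (neighbours≤ w))

  separated-centres⇒ContainsKStars : ∀ {k d} (c : Fin k → Fin N) → (∀ i → degree G (c i) ≡ d) →
    (∀ i j → i ≢ j → ¬ ClosedNeighbourhoodsMeet (c i) (c j)) → ContainsKStars G k d
  separated-centres⇒ContainsKStars {k} {d} c deg≡d separated = f , f-injective , centre-leaf-adjacent
    where
    leaves : ∀ i → Σ (Fin d → Fin N) λ g → (∀ j → g j ∈ neighbours (c i)) × Injective _≡_ _≡_ g
    leaves i = Unique⇒injection-from-Fin (neighbours (c i)) (neighbours-unique (c i))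
                 (trans (length-neighbours (c i)) (deg≡d i))
    f : Fin k × Fin (suc d) → Fin N
    f (i , Fin.zero)  = c i
    f (i , Fin.suc j) = proj₁ (leaves i) j
    centre-leaf-adjacent : ∀ i j → Adj G (f (i , Fin.zero)) (f (i , Fin.suc j)) ≡ true
    centre-leaf-adjacent i j = ∈neighbours⇒adjacent (proj₁ (proj₂ (leaves i)) j)
    f-star : ∀ i a → InClosedNeighbourhood (c i) (f (i , a))
    f-star i Fin.zero    = inj₁ refl
    f-star i (Fin.suc j) = inj₂ (centre-leaf-adjacent i j)
    centre≢leaf : ∀ i j → c i ≢ f (i , Fin.suc j)
    centre≢leaf i j ci≡leaf = contradiction
      (trans (≡.sym (Graph.irrefl G (c i))) (subst (λ x → Adj G (c i) x ≡ true) (≡.sym ci≡leaf) (centre-leaf-adjacent i j)))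
      (λ ())
    f-injective-on-star : ∀ i {a b} → f (i , a) ≡ f (i , b) → a ≡ b
    f-injective-on-star i {Fin.zero}  {Fin.zero}  _  = refl
    f-injective-on-star i {Fin.zero}  {Fin.suc j} eq = contradiction eq (centre≢leaf i j)
    f-injective-on-star i {Fin.suc j} {Fin.zero}  eq = contradiction (≡.sym eq) (centre≢leaf i j)
    f-injective-on-star i {Fin.suc j} {Fin.suc l} eq = cong Fin.suc (proj₂ (proj₂ (leaves i)) eq)
    f-injective : Injective _≡_ _≡_ f
    f-injective {i , a} {i′ , a′} fx≡fy with i ≟ᶠ i′
    ... | yes refl = cong (i ,_) (f-injective-on-star i fx≡fy)
    ... | no  i≢i′ = contradiction
      (f (i , a) , f-star i a , subst (InClosedNeighbourhood (c i′)) (≡.sym fx≡fy) (f-star i′ a′))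
      (separated i i′ i≢i′)

  many-maximum-degree⇒ContainsKStars : ∀ {d} k → MaxDegreeAtMost G d →
    (k ∸ 1) * suc (d * d) < numDegree G d → ContainsKStars G k d
  many-maximum-degree⇒ContainsKStars {d} k Δ≤d many = separated-centres⇒ContainsKStars c deg≡d separated
    where
    open GreedyIndependent _≟ᶠ_ closedNeighbourhoodsMeet? closedNeighbourhoodsMeet-sym
      secondNeighbourhood (d * d) ∈-secondNeighbourhood (length-secondNeighbourhood≤ Δ≤d)
    hasDegree? : Decidable (λ v → T ⌊ degree G v ≟ d ⌋)
    hasDegree? v = T? ⌊ degree G v ≟ d ⌋
    S : List (Fin N)
    S = filter hasDegree? (allFin N)
    chosen : Independent k S
    chosen = length>⇒Independent k S (Unique.filter⁺ hasDegree? (Unique.allFin⁺ N))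
      (subst (_ <_) (sum-indicator≡length-filter (λ v → ⌊ degree G v ≟ d ⌋) (allFin N)) many)
    c : Fin k → Fin N
    c = proj₁ chosen
    separated : ∀ i j → i ≢ j → ¬ ClosedNeighbourhoodsMeet (c i) (c j)
    separated = proj₂ (proj₂ chosen)
    deg≡d : ∀ i → degree G (c i) ≡ d
    deg≡d i = toWitness (proj₂ (∈-filter⁻ hasDegree? {xs = allFin N} (proj₁ (proj₂ chosen) i)))

lemma4p6 : (n l d k : ℕ) (H : Graph (n ∸ l)) →
    MaxDegreeAtMost H d →
    ¬ ContainsKStars H k d →
    numDegree H d ≤ (k ∸ 1) * (d ^ 2 + 1)
lemma4p6 n l d k H Δ≤d kS⊈H with numDegree H d ≤? (k ∸ 1) * (d ^ 2 + 1)
... | yes few = few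
... | no  many = contradiction
  (Neighbourhoods.many-maximum-degree⇒ContainsKStars H k Δ≤d
    (subst (λ D → (k ∸ 1) * D < numDegree H d) d²+1≡1+d*d (≰⇒> many)))
  kS⊈H
  where
  d²+1≡1+d*d : d ^ 2 + 1 ≡ suc (d * d)
  d²+1≡1+d*d = trans (+-comm (d ^ 2) 1) (cong (λ e → suc (d * e)) (*-identityʳ d))
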